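{- Let $A\subset\mathbb{Z}$ be an arithmetic progression of integers of size $r$. Then $A$ has the $r$-order property.
   Context: For $k\in\mathbb{N}$, a set $A$ in an Abelian group $G$ (here $G=\mathbb{Z}$) has the $k$-order property if there are vectors $a,b\in G^k$ such that for all $1\le i,j\le k$, $a_i+b_j\in A$ if and only if $i\le j$. -}

module Defs where

open import Level using (Level; _⊔_; suc)
open import Data.Nat using (ℕ; _<_)
open import Data.Integer using (ℤ; _+_; _*_; +_)
open import Data.Fin using (Fin; _≤_)
open import Data.Product using (Σ; ∃; _×_)
open import Function.Bundles using (_⇔_)
open import Relation.Binary.PropositionalEquality using (_≡_; _≢_)

Subset : (ℓ : Level) → Set (Level.suc ℓ)
Subset ℓ = ℤ → Set ℓ

-- A is an arithmetic progression of size r: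
-- A = { a₀ + i·d : 0 ≤ i < r } with common difference d ≠ 0
-- (so the r listed elements are distinct and |A| = r).
IsAPOfSize : {ℓ : Level} → Subset ℓ → ℕ → Set ℓ
IsAPOfSize A r =
  Σ ℤ λ a₀ → Σ ℤ λ d → (d ≢ + 0) ×
    ((x : ℤ) → (A x ⇔ Σ ℕ λ i → (i < r) × (x ≡ a₀ + (+ i) * d)))

OrderProperty : {ℓ : Level} → ℕ → Subset ℓ → Set ℓ
OrderProperty k A =
  Σ (Fin k → ℤ) λ a → Σ (Fin k → ℤ) λ b →
    (i j : Fin k) → (A (a i + b j) ⇔ i ≤ j)

module Submission where

-- Write A = { a₀ + i·d : i < r } with d ≠ 0 and choose
--   a_i = a₀ − i·d,   b_j = j·d,
-- so that a_i + b_j = a₀ + (j − i)·d.  Since d ≠ 0 the map t ↦ a₀ + t·d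
-- is injective, hence a point a₀ + t·d of this line lies in A exactly when
-- the integer t is a natural number below r.  For indices i, j < r the
-- integer j − i is such a number exactly when i ≤ j: the witness is j ∸ i,
-- and conversely j − i = k ≥ 0 forces i ≤ j.

open import Defs
open import Level using (Level)
open import Algebra.Bundles using (AbelianGroup)
open import Data.Nat using (ℕ; _<_; _≤_; _∸_) renaming (_+_ to _+ℕ_)
import Data.Nat.Properties as ℕ
open import Data.Integer using (ℤ; +_; _+_; _-_; _*_; ≢-nonZero)
import Data.Integer.Properties as ℤ
open import Data.Integer.Tactic.RingSolver using (solve-∀)
open import Data.Fin as Fin using (Fin; toℕ)
open import Data.Fin.Properties using (toℕ<n)
open import Data.Product using (Σ; _,_; _×_)
open import Function.Bundles using (_⇔_; mk⇔; Equivalence)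
open import Function.Construct.Composition using (_⇔-∘_)
open import Relation.Binary.PropositionalEquality
  using (_≡_; _≢_; cong; sym; trans; module ≡-Reasoning)

open import Algebra.Properties.Group (AbelianGroup.group ℤ.+-0-abelianGroup)
  using (∙-cancelˡ; //-rightDividesˡ)

affine-injective : (c d : ℤ) {s t : ℤ} → d ≢ + 0 → c + s * d ≡ c + t * d → s ≡ t
affine-injective c d {s} {t} d≢0 eq =
  ℤ.*-cancelʳ-≡ s t d {{≢-nonZero d≢0}} (∙-cancelˡ c (s * d) (t * d) eq)

-- Stepping back x steps and forward y steps of size d moves y − x steps:
-- this is how a_i + b_j lands on the line of the progression.
shift-along-line : (c d x y : ℤ) → c - x * d + y * d ≡ c + (y - x) * d
shift-along-line = solve-∀

ap-member-on-line : {ℓ : Level} {A : Subset ℓ} {r : ℕ} (a₀ d : ℤ) → d ≢ + 0 →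
  ((x : ℤ) → (A x ⇔ Σ ℕ λ i → (i < r) × (x ≡ a₀ + (+ i) * d))) →
  (t : ℤ) → (A (a₀ + t * d) ⇔ Σ ℕ λ i → (i < r) × (t ≡ + i))
ap-member-on-line {A = A} {r} a₀ d d≢0 mem t = mk⇔ index-of point-of
  where
  index-of : A (a₀ + t * d) → Σ ℕ λ i → (i < r) × (t ≡ + i)
  index-of t∈A with Equivalence.to (mem (a₀ + t * d)) t∈A
  ... | i , i<r , eq = i , i<r , affine-injective a₀ d d≢0 eq
  point-of : (Σ ℕ λ i → (i < r) × (t ≡ + i)) → A (a₀ + t * d)
  point-of (i , i<r , t≡i) =
    Equivalence.from (mem (a₀ + t * d)) (i , i<r , cong (λ s → a₀ + s * d) t≡i)

difference-in-range⇔≤ : {r i j : ℕ} → j < r →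
  (Σ ℕ λ k → (k < r) × (+ j - + i ≡ + k)) ⇔ (i ≤ j)
difference-in-range⇔≤ {r} {i} {j} j<r = mk⇔ nonnegative⇒≤ ≤⇒in-range
  where
  nonnegative⇒≤ : (Σ ℕ λ k → (k < r) × (+ j - + i ≡ + k)) → i ≤ j
  nonnegative⇒≤ (k , _ , j-i≡k) = ℕ.≤-trans (ℕ.m≤n+m i k) (ℕ.≤-reflexive (sym j≡k+i))
    where
    open ≡-Reasoning
    j≡k+i : j ≡ k +ℕ i
    j≡k+i = ℤ.+-injective (begin
      + j               ≡⟨ sym (//-rightDividesˡ (+ i) (+ j)) ⟩
      (+ j - + i) + + i ≡⟨ cong (_+ + i) j-i≡k ⟩
      + k + + i         ≡⟨ sym (ℤ.pos-+ k i) ⟩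
      + (k +ℕ i) ∎)
  ≤⇒in-range : i ≤ j → Σ ℕ λ k → (k < r) × (+ j - + i ≡ + k)
  ≤⇒in-range i≤j =
    j ∸ i , ℕ.≤-<-trans (ℕ.m∸n≤m j i) j<r , trans (ℤ.m-n≡m⊖n j i) (ℤ.⊖-≥ i≤j)

lemma1p6 : {ℓ : Level} (A : Subset ℓ) (r : ℕ) → IsAPOfSize A r → OrderProperty r A
lemma1p6 A r (a₀ , d , d≢0 , mem) = a , b , order
  where
  a b : Fin r → ℤ
  a i = a₀ - (+ toℕ i) * d
  b j = (+ toℕ j) * d

  -- A (a_i + b_j)  ⇔  j − i is a natural number below r  ⇔  i ≤ j.
  order : (i j : Fin r) → (A (a i + b j) ⇔ i Fin.≤ j)
  order i j rewrite shift-along-line a₀ d (+ toℕ i) (+ toℕ j) =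
    difference-in-range⇔≤ (toℕ<n j)
      ⇔-∘ ap-member-on-line a₀ d d≢0 mem (+ toℕ j - + toℕ i)
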